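{- Let $A=\{a,b\}$ and $\mathtt{P}=\{p,q\}$. Let $M=\langle W,R,V\rangle$ with $W=\{w_0,u_0,u_1\}$, $V(p)=\{w_0,u_0\}$, $V(q)=\{u_0\}$, $R_a=W\times W$, and $R_b=\{(x,x)\mid x\in W\}\cup\{(w_0,u_0),(u_0,w_0)\}$. Then there is no $\xi\in\mathcal{L}_D$ such that the models $M^{!\xi}$ and $M^{\{a,b\},\,p\leftrightarrow q}$ are collectively $\mathtt{P}$-bisimilar (i.e., there is no collective $\mathtt{P}$-bisimulation between them).
   Context: A model is $M=\langle W,R,V\rangle$ with $W$ non-empty, $R=\{R_i\subseteq W\times W\mid i\in A\}$, $V:\mathtt{P}\to\mathcal{P}(W)$; $R_G:=\bigcap_{k\in G}R_k$ (with $R_\emptyset:=W\times W$). $\mathcal{L}_D$: $\varphi::=p\mid\lnot\varphi\mid\varphi\land\varphi\mid D_G\varphi$ ($\emptyset\neq G\subseteq A$), with $(M,w)\Vdash D_G\varphi$ iff $\varphi$ holds at all $u$ with $(w,u)\in R_G$. $\|\chi\|^M$ is the truth set of $\chi$ in $M$; $\sim^M_\chi:=(\|\chi\|^M\times\|\chi\|^M)\cup(\|\lnot\chi\|^M\times\|\lnot\chi\|^M)$. Partial communication: $M^{S,\chi}=\langle W,R^{S,\chi},V\rangle$ with $R^{S,\chi}_i:=R_i\cap(R_S\cup\sim^M_\chi)$. Public announcement: $M^{!\xi}=\langle W,R^{!\xi},V\rangle$ with $R^{!\xi}_i:=R_i\cap\sim^M_\xi$. A collective $\mathtt{P}$-bisimulation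 between $M=\langle W,R,V\rangle$ and $M'=\langle W',R',V'\rangle$ is a non-empty $Z\subseteq W\times W'$ such that for every $(u,u')\in Z$: $u,u'$ satisfy the same atoms; for every $G\subseteq A$ and $(u,v)\in R_G$ there is $v'$ with $(u',v')\in R'_G$, $(v,v')\in Z$; and symmetrically for $(u',v')\in R'_G$. -}

module Defs where

open import Data.Bool using (Bool; true; false)
open import Data.Product using (Σ; ∃; _×_; _,_)
open import Data.Sum using (_⊎_)
open import Data.Unit using (⊤)
open import Data.Empty using (⊥)
open import Relation.Nullary using (¬_)
open import Relation.Binary.PropositionalEquality using (_≡_)

data Agent : Set where
  a b : Agent

data Atom : Set where
  p q : Atom

Group : Set
Group = Agent → Bool

NonEmpty : Group → Set
NonEmpty G = ∃ λ i → G i ≡ true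

record Model : Set₁ where
  field
    W   : Set
    w∃  : W
    R   : Agent → W → W → Set
    V   : Atom → W → Set
open Model public

-- R_G := ⋂_{k∈G} R_k  (R_∅ = W × W automatically)
RG : (M : Model) → Group → W M → W M → Set
RG M G u v = ∀ i → G i ≡ true → R M i u v

data Form : Set where
  atom : Atom → Form
  ¬'_  : Form → Form
  _∧'_ : Form → Form → Form
  D    : (G : Group) → NonEmpty G → Form → Form

_,_⊩_ : (M : Model) → W M → Form → Set
M , w ⊩ atom x = V M x w
M , w ⊩ (¬' φ) = ¬ (M , w ⊩ φ)
M , w ⊩ (φ ∧' ψ) = (M , w ⊩ φ) × (M , w ⊩ ψ)
M , w ⊩ D G _ φ = ∀ u → RG M G w u → M , u ⊩ φ

Sim : (M : Model) → Form → W M → W M → Set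
Sim M χ u v = ((M , u ⊩ χ) × (M , v ⊩ χ)) ⊎ ((M , u ⊩ (¬' χ)) × (M , v ⊩ (¬' χ)))

partialComm : (M : Model) → Group → Form → Model
partialComm M S χ = record
  { W = W M ; w∃ = w∃ M ; V = V M
  ; R = λ i u v → R M i u v × (RG M S u v ⊎ Sim M χ u v) }

announce : (M : Model) → Form → Model
announce M ξ = record
  { W = W M ; w∃ = w∃ M ; V = V M
  ; R = λ i u v → R M i u v × Sim M ξ u v }

record IsCollectiveBisim (M M' : Model) (Z : W M → W M' → Set) : Set where
  field
    nonempty : Σ (W M) λ u → Σ (W M') λ u' → Z u u'
    atoms    : ∀ u u' → Z u u' → ∀ x → (V M x u → V M' x u') × (V M' x u' → V M x u)
    forth    : ∀ u u' → Z u u' → ∀ (G : Group) v → RG M G u v →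
               Σ (W M') λ v' → RG M' G u' v' × Z v v'
    back     : ∀ u u' → Z u u' → ∀ (G : Group) v' → RG M' G u' v' →
               Σ (W M) λ v → RG M G u v × Z v v'

CollectivelyBisimilar : Model → Model → Set₁
CollectivelyBisimilar M M' = Σ (W M → W M' → Set) λ Z → IsCollectiveBisim M M' Z

data World : Set where
  w0 u0 u1 : World

Vex : Atom → World → Set
Vex p w0 = ⊤
Vex p u0 = ⊤
Vex p u1 = ⊥
Vex q u0 = ⊤
Vex q _  = ⊥

Rex : Agent → World → World → Set
Rex a _ _ = ⊤
Rex b w0 w0 = ⊤
Rex b u0 u0 = ⊤
Rex b u1 u1 = ⊤
Rex b w0 u0 = ⊤
Rex b u0 w0 = ⊤
Rex b _ _ = ⊥

Mex : Model
Mex = record { W = World ; w∃ = w0 ; R = Rex ; V = Vex }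

allAgents : Group
allAgents _ = true

_↔'_ : Form → Form → Form
φ ↔' ψ = (¬' (φ ∧' (¬' ψ))) ∧' (¬' (ψ ∧' (¬' φ)))

{-# OPTIONS --safe #-}
module Submission where

open import Defs
open import Relation.Nullary using (¬_)
open import Data.Bool using (true; false)
open import Data.Product using (Σ; _×_; _,_; proj₁; proj₂)
open import Data.Sum using (inj₁; inj₂)
open import Data.Unit using (tt)
open import Data.Empty using (⊥-elim)
open import Relation.Binary.PropositionalEquality using (_≡_; refl; subst)

-- In Mex every world is determined by its atoms, so any collective bisimulation
-- between two models on Mex's worlds and valuation is the identity; forth and back
-- then transfer each R_a-edge unchanged. In M^{{a,b},p↔q} agent a still links u0
-- to w0 (via R_{a,b}) and to u1 (both satisfy p ↔ q), so ξ cannot separate u0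
-- from w0 or u1, hence not w0 from u1; but in M^{{a,b},p↔q} agent a separates w0
-- from u1.

∅ᴳ : Group
∅ᴳ _ = false

⟨a⟩ : Group
⟨a⟩ a = true
⟨a⟩ b = false

RG-⟨a⟩ : ∀ (M : Model) {x y} → R M a x y → RG M ⟨a⟩ x y
RG-⟨a⟩ M r a refl = r

Sim-sym : ∀ (M : Model) ξ {x y} → Sim M ξ x y → Sim M ξ y x
Sim-sym M ξ (inj₁ (hx , hy)) = inj₁ (hy , hx)
Sim-sym M ξ (inj₂ (nx , ny)) = inj₂ (ny , nx)

Sim-trans : ∀ (M : Model) ξ {x y z} → Sim M ξ x y → Sim M ξ y z → Sim M ξ x z
Sim-trans M ξ (inj₁ (hx , _)) (inj₁ (_ , hz)) = inj₁ (hx , hz)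
Sim-trans M ξ (inj₁ (_ , hy)) (inj₂ (ny , _)) = ⊥-elim (ny hy)
Sim-trans M ξ (inj₂ (_ , ny)) (inj₁ (hy , _)) = ⊥-elim (ny hy)
Sim-trans M ξ (inj₂ (nx , _)) (inj₂ (_ , nz)) = inj₂ (nx , nz)

back-surjective : ∀ {M M' Z} → IsCollectiveBisim M M' Z → ∀ v' → Σ (W M) λ v → Z v v'
back-surjective bis v' with IsCollectiveBisim.nonempty bis
... | u , u' , z with IsCollectiveBisim.back bis u u' z ∅ᴳ v' (λ _ ())
... | v , _ , zv = v , zv

Vex-injective : ∀ x y → (∀ t → (Vex t x → Vex t y) × (Vex t y → Vex t x)) → x ≡ y
Vex-injective w0 w0 _ = refl
Vex-injective w0 u0 h = ⊥-elim (proj₂ (h q) tt)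
Vex-injective w0 u1 h = ⊥-elim (proj₁ (h p) tt)
Vex-injective u0 w0 h = ⊥-elim (proj₁ (h q) tt)
Vex-injective u0 u0 _ = refl
Vex-injective u0 u1 h = ⊥-elim (proj₁ (h p) tt)
Vex-injective u1 w0 h = ⊥-elim (proj₂ (h p) tt)
Vex-injective u1 u0 h = ⊥-elim (proj₂ (h p) tt)
Vex-injective u1 u1 _ = refl

p↔q : Form
p↔q = atom p ↔' atom q

Mex-w0⊮p↔q : ¬ (Mex , w0 ⊩ p↔q)
Mex-w0⊮p↔q (¬[p∧¬q] , _) = ¬[p∧¬q] (tt , λ ())

Mex-u0⊩p↔q : Mex , u0 ⊩ p↔q
Mex-u0⊩p↔q = (λ (_ , ¬q) → ¬q tt) , (λ (_ , ¬p) → ¬p tt)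

Mex-u1⊩p↔q : Mex , u1 ⊩ p↔q
Mex-u1⊩p↔q = (λ ()) , (λ ())

Mpc : Model
Mpc = partialComm Mex allAgents p↔q

Mpc-a-u0-w0 : R Mpc a u0 w0
Mpc-a-u0-w0 = tt , inj₁ λ { a _ → tt ; b _ → tt }

Mpc-a-u0-u1 : R Mpc a u0 u1
Mpc-a-u0-u1 = tt , inj₂ (inj₁ (Mex-u0⊩p↔q , Mex-u1⊩p↔q))

Mpc-¬a-w0-u1 : ¬ R Mpc a w0 u1
Mpc-¬a-w0-u1 (_ , inj₁ rab) = rab b refl
Mpc-¬a-w0-u1 (_ , inj₂ (inj₁ (w0⊩ , _))) = Mex-w0⊮p↔q w0⊩
Mpc-¬a-w0-u1 (_ , inj₂ (inj₂ (_ , u1⊮))) = u1⊮ Mex-u1⊩p↔q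

fact3p4 : (ξ : Form) →
    ¬ CollectivelyBisimilar (announce Mex ξ) (partialComm Mex allAgents (atom p ↔' atom q))
fact3p4 ξ (Z , bis) = Mpc-¬a-w0-u1 (edge-forth (RG-⟨a⟩ (announce Mex ξ) (tt , w0∼u1)) a refl)
  where
  open IsCollectiveBisim bis

  Z⇒≡ : ∀ {x y} → Z x y → x ≡ y
  Z⇒≡ {x} {y} z = Vex-injective x y (atoms x y z)

  Z-refl : ∀ y → Z y y
  Z-refl y with back-surjective bis y
  ... | v , zv = subst (λ t → Z t y) (Z⇒≡ zv) zv

  edge-forth : ∀ {G x y} → RG (announce Mex ξ) G x y → RG Mpc G x y
  edge-forth {G} {x} {y} r with forth x x (Z-refl x) G y r
  ... | y' , r' , zy with Z⇒≡ zy
  ... | refl = r'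

  edge-back : ∀ {G x y} → RG Mpc G x y → RG (announce Mex ξ) G x y
  edge-back {G} {x} {y} r with back x x (Z-refl x) G y r
  ... | y' , r' , zy with Z⇒≡ zy
  ... | refl = r'

  ξ-Sim-from-a : ∀ {x y} → R Mpc a x y → Sim Mex ξ x y
  ξ-Sim-from-a r = proj₂ (edge-back (RG-⟨a⟩ Mpc r) a refl)

  w0∼u1 : Sim Mex ξ w0 u1
  w0∼u1 = Sim-trans Mex ξ (Sim-sym Mex ξ (ξ-Sim-from-a Mpc-a-u0-w0)) (ξ-Sim-from-a Mpc-a-u0-u1)
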